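{- Let $(G,T,p)$ be an instance of Directed Vertex Multiway Cut and let $G^{*}$ be the underlying undirected graph of $G$. If $S$ is a shadowless solution of $(G,T,p)$, then $S$ is also a solution of the instance $(G^{*},T,p)$ of Undirected Multiway Cut, i.e. $S\subseteq V(G)\setminus V^{\infty}(G)$, $|S|\le p$, and $G^{*}\setminus S$ has no path between any two distinct terminals.
   Context: An instance $(G,T,p)$ of Directed Vertex Multiway Cut consists of a directed graph $G$, terminals $T\subseteq V(G)$, a set of distinguished vertices $V^{\infty}(G)\supseteq T$ and an integer $p$; a solution is a set $S\subseteq V(G)\setminus V^{\infty}(G)$ with $|S|\le p$ such that $G\setminus S$ has no directed path from $t_i$ to $t_j$ for distinct $t_i,t_j\in T$. For disjoint nonempty $X,Y\subseteq V(G)$, a set $S\subseteq V(G)\setminus(X\cup Y\cup V^{\infty}(G))$ is an $X-Y$ separator if $G\setminus S$ has no directed path from $X$ to $Y$. The forward shadow $f(S)$ is the set of vertices $v$ such that $S$ is a $T-\{v\}$ separator; the reverse shadow $r(S)$ is the set of vertices $v$ such that $S$ is a $\{v\}-T$ separator. A solution $S$ is shadowless if $f(S)=r(S)=\emptyset$. -}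

module Defs where

open import Data.Nat using (ℕ; _≤_)
open import Data.Fin using (Fin)
open import Data.Fin.Subset using (Subset; _∈_; _∉_; _⊆_; ∣_∣; ⁅_⁆)
open import Data.Product using (_×_; Σ)
open import Data.Sum using (_⊎_)
open import Relation.Binary.PropositionalEquality using (_≡_)
open import Relation.Nullary using (¬_)

record Digraph (n : ℕ) : Set₁ where
  field
    Arc : Fin n → Fin n → Set

open Digraph public

record DVMCInstance (n : ℕ) : Set₁ where
  field
    G    : Digraph n
    T    : Subset n
    Vinf : Subset n
    T⊆Vinf : T ⊆ Vinf
    p    : ℕ

open DVMCInstance public

data DPathAvoiding {n : ℕ} (G : Digraph n) (S : Subset n) : Fin n → Fin n → Set where
  here : ∀ {u} → u ∉ S → DPathAvoiding G S u u
  step : ∀ {u w v} → u ∉ S → Arc G u w → DPathAvoiding G S w v → DPathAvoiding G S u v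

UEdge : ∀ {n} → Digraph n → Fin n → Fin n → Set
UEdge G u w = Arc G u w ⊎ Arc G w u

data UPathAvoiding {n : ℕ} (G : Digraph n) (S : Subset n) : Fin n → Fin n → Set where
  here : ∀ {u} → u ∉ S → UPathAvoiding G S u u
  step : ∀ {u w v} → u ∉ S → UEdge G u w → UPathAvoiding G S w v → UPathAvoiding G S u v

IsDirSolution : ∀ {n} → DVMCInstance n → Subset n → Set
IsDirSolution I S =
  (∀ {x} → x ∈ S → x ∉ Vinf I) ×
  ∣ S ∣ ≤ p I ×
  (∀ {s t} → s ∈ T I → t ∈ T I → ¬ (s ≡ t) → ¬ DPathAvoiding (G I) S s t)

IsUndirSolution : ∀ {n} → DVMCInstance n → Subset n → Set
IsUndirSolution I S =
  (∀ {x} → x ∈ S → x ∉ Vinf I) ×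
  ∣ S ∣ ≤ p I ×
  (∀ {s t} → s ∈ T I → t ∈ T I → ¬ (s ≡ t) → ¬ UPathAvoiding (G I) S s t)

Disjoint : ∀ {n} → Subset n → Subset n → Set
Disjoint X Y = ∀ {x} → x ∈ X → x ∉ Y

NonEmpty : ∀ {n} → Subset n → Set
NonEmpty {n} X = Σ (Fin n) (λ x → x ∈ X)

IsSeparator : ∀ {n} → DVMCInstance n → Subset n → Subset n → Subset n → Set
IsSeparator I X Y S =
  Disjoint X Y × NonEmpty X × NonEmpty Y ×
  (∀ {x} → x ∈ S → x ∉ X × x ∉ Y × x ∉ Vinf I) ×
  (∀ {x y} → x ∈ X → y ∈ Y → ¬ DPathAvoiding (G I) S x y)

InForwardShadow : ∀ {n} → DVMCInstance n → Subset n → Fin n → Set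
InForwardShadow I S v = IsSeparator I (T I) ⁅ v ⁆ S

InReverseShadow : ∀ {n} → DVMCInstance n → Subset n → Fin n → Set
InReverseShadow I S v = IsSeparator I ⁅ v ⁆ (T I) S

IsShadowless : ∀ {n} → DVMCInstance n → Subset n → Set
IsShadowless I S = (∀ v → ¬ InForwardShadow I S v) × (∀ v → ¬ InReverseShadow I S v)

module Submission where

-- Call a terminal a a *source* of a vertex u if G \ S has a directed
-- path from a to u.  Let S be a shadowless solution.
--   * Every u ∉ S has a source (u is not in the forward shadow f(S)) and
--     reaches some terminal c (u is not in the reverse shadow r(S)).
--   * Sources are unique: if a and b both reach u and u reaches c, then
--     a = c = b, since S separates distinct terminals.
--   * An undirected edge u ~ w of G* \ S keeps the source: along u → w a
--     source of u is a source of w; along w → u a source b of w is a source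
--     of u, hence equals the source of u.
-- So the source is constant along every path of G* \ S; as each terminal is
-- its own source, such a path joins a terminal only to itself.  The
-- existence statements hold only up to double negation (reachability is not
-- decidable), which suffices because equality of vertices is decidable.

open import Defs
open import Data.Nat using (ℕ)
open import Data.Fin using (Fin)
open import Data.Fin.Properties using (_≟_)
open import Data.Fin.Subset using (Subset; _∈_; _∉_; ⁅_⁆)
open import Data.Fin.Subset.Properties using (_∈?_; x∈⁅x⁆; x∈⁅y⁆⇒x≡y)
open import Data.Product using (_×_; _,_; proj₁; proj₂; ∃-syntax)
open import Data.Sum using (inj₁; inj₂)
open import Relation.Nullary using (¬_; yes; no)
open import Relation.Nullary.Decidable using (decidable-stable)
open import Relation.Nullary.Negation using (contradiction)
open import Relation.Binary.PropositionalEquality using (_≡_; sym; trans; subst)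

module PathFacts {n : ℕ} (G : Digraph n) (S : Subset n) where

  _++_ : ∀ {a b c} → DPathAvoiding G S a b → DPathAvoiding G S b c →
         DPathAvoiding G S a c
  here _       ++ q = q
  step u∉ e p ++ q = step u∉ e (p ++ q)

  dpath-end∉ : ∀ {a b} → DPathAvoiding G S a b → b ∉ S
  dpath-end∉ (here b∉)     = b∉
  dpath-end∉ (step _ _ p) = dpath-end∉ p

  upath-start∉ : ∀ {a b} → UPathAvoiding G S a b → a ∉ S
  upath-start∉ (here a∉)     = a∉
  upath-start∉ (step a∉ _ _) = a∉

  extend : ∀ {a u w} → DPathAvoiding G S a u → Arc G u w → w ∉ S →
           DPathAvoiding G S a w
  extend p e w∉ = p ++ step (dpath-end∉ p) e (here w∉)

∉⁅⁆ : ∀ {n} {S : Subset n} {u x : Fin n} → u ∉ S → x ∈ S → x ∉ ⁅ u ⁆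
∉⁅⁆ {S = S} {u} u∉ x∈S x∈u = u∉ (subst (_∈ S) (x∈⁅y⁆⇒x≡y u x∈u) x∈S)

module SourceArgument {n : ℕ} (I : DVMCInstance n) (S : Subset n)
                      (sol : IsDirSolution I S) where
  open PathFacts (G I) S

  DP : Fin n → Fin n → Set
  DP = DPathAvoiding (G I) S

  Source : Fin n → Fin n → Set
  Source a u = a ∈ T I × DP a u

  S∩T=∅ : ∀ {x} → x ∈ S → x ∉ T I
  S∩T=∅ x∈S x∈T = proj₁ sol x∈S (T⊆Vinf I x∈T)

  terminals-separated : ∀ {a b} → a ∈ T I → b ∈ T I → DP a b → a ≡ b
  terminals-separated {a} {b} a∈T b∈T p with a ≟ b
  ... | yes a≡b = a≡b
  ... | no  a≢b = contradiction p (proj₂ (proj₂ sol) a∈T b∈T a≢b)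

  sink-exists : ∀ {a u} → a ∈ T I → u ∉ S → ¬ InReverseShadow I S u →
                ¬ ¬ (∃[ c ] (c ∈ T I × DP u c))
  sink-exists {a} {u} a∈T u∉ u-not-in-r no-sink with u ∈? T I
  ... | yes u∈T = no-sink (u , u∈T , here u∉)
  ... | no  u∉T = u-not-in-r
    ( (λ x∈u x∈T → u∉T (subst (_∈ T I) (x∈⁅y⁆⇒x≡y u x∈u) x∈T))
    , (u , x∈⁅x⁆ u) , (a , a∈T)
    , (λ x∈S → ∉⁅⁆ u∉ x∈S , S∩T=∅ x∈S , proj₁ sol x∈S)
    , λ {x} {c} x∈u c∈T p →
        no-sink (c , c∈T , subst (λ z → DP z c) (x∈⁅y⁆⇒x≡y u x∈u) p) )

  source-exists : ∀ {a w} → a ∈ T I → w ∉ S → ¬ InForwardShadow I S w →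
                  ¬ ¬ (∃[ b ] Source b w)
  source-exists {a} {w} a∈T w∉ w-not-in-f no-source with w ∈? T I
  ... | yes w∈T = no-source (w , w∈T , here w∉)
  ... | no  w∉T = w-not-in-f
    ( (λ x∈T x∈w → w∉T (subst (_∈ T I) (x∈⁅y⁆⇒x≡y w x∈w) x∈T))
    , (a , a∈T) , (w , x∈⁅x⁆ w)
    , (λ x∈S → S∩T=∅ x∈S , ∉⁅⁆ w∉ x∈S , proj₁ sol x∈S)
    , λ {b} {y} b∈T y∈w p →
        no-source (b , b∈T , subst (DP b) (x∈⁅y⁆⇒x≡y w y∈w) p) )

  module _ (shadowless : IsShadowless I S) where

    -- Sources are unique: both reach a common terminal sink of u.
    source-unique : ∀ {a b u} → Source a u → Source b u → a ≡ b
    source-unique {a} {b} {u} (a∈T , pa) (b∈T , pb) =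
      decidable-stable (a ≟ b) λ a≢b →
        sink-exists a∈T (dpath-end∉ pa) (proj₂ shadowless u)
          λ (c , c∈T , pc) →
            a≢b (trans (terminals-separated a∈T c∈T (pa ++ pc))
                       (sym (terminals-separated b∈T c∈T (pb ++ pc))))

    source-invariant : ∀ {a u t} → Source a u → UPathAvoiding (G I) S u t →
                       t ∈ T I → a ≡ t
    source-invariant src (here t∉) t∈T =
      source-unique src (t∈T , here t∉)
    source-invariant (a∈T , pa) (step _ (inj₁ u→w) q) t∈T =
      source-invariant (a∈T , extend pa u→w (upath-start∉ q)) q t∈T
    source-invariant {a} {t = t} (a∈T , pa) (step {w = w} _ (inj₂ w→u) q) t∈T =
      decidable-stable (a ≟ t) λ a≢t →
        source-exists a∈T (upath-start∉ q) (proj₁ shadowless w)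
          λ (b , b∈T , pb) →
            let b-sources-u = (b∈T , extend pb w→u (dpath-end∉ pa))
            in a≢t (trans (source-unique (a∈T , pa) b-sources-u)
                          (source-invariant (b∈T , pb) q t∈T))

lemma3 : ∀ {n : ℕ} (I : DVMCInstance n) (S : Subset n) →
    IsDirSolution I S → IsShadowless I S → IsUndirSolution I S
lemma3 I S sol shadowless =
  proj₁ sol , proj₁ (proj₂ sol) ,
  λ s∈T t∈T s≢t q →
    s≢t (source-invariant sol shadowless
           (s∈T , here (PathFacts.upath-start∉ (G I) S q)) q t∈T)
  where open SourceArgument I S
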